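{- For every integer $n \ge 12$, $\mathrm{indsat}(n,C_4) = 0$.
   Context: All graphs are finite and simple; $C_4$ is the cycle on four vertices. A trigraph $T$ consists of a finite vertex set $V(T)$ together with a partition of the set of unordered pairs of distinct vertices of $V(T)$ into black edges, white edges and gray edges. A realization of $T$ is a graph with vertex set $V(T)$ whose edge set consists of all black edges together with some subset of the gray edges. For a graph $H$, a trigraph $T$ is $H$-induced-saturated if no realization of $T$ contains an induced subgraph isomorphic to $H$, but for every black or white edge $e$ of $T$, the trigraph obtained from $T$ by changing $e$ to gray has a realization containing an induced subgraph isomorphic to $H$. The induced saturation number $\mathrm{indsat}(n,H)$ is the minimum number of gray edges in an $H$-induced-saturated trigraph on $n$ vertices. -}

module Defs where

open import Data.Nat using (ℕ; _<_; _≤_)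
open import Data.Fin using (Fin; zero; suc; toℕ)
open import Data.Bool using (Bool; true; false)
open import Data.List using (List; length; filter; allFin; concatMap; map)
open import Data.Product using (Σ; _×_; _,_; ∃-syntax)
open import Relation.Nullary using (¬_; Dec; yes; no)
open import Relation.Nullary.Decidable using (_×-dec_)
open import Relation.Binary.PropositionalEquality using (_≡_; refl)
open import Function.Definitions using (Injective)
open import Data.Nat.Properties using (<-cmp)
import Data.Nat as ℕ

record Graph (n : ℕ) : Set where
  field
    adj   : Fin n → Fin n → Bool
    sym   : ∀ i j → adj i j ≡ adj j i
    loopless : ∀ i → adj i i ≡ false
open Graph public

InducedCopy : ∀ {k n} → Graph k → Graph n → Set
InducedCopy {k} {n} H G =
  Σ (Fin k → Fin n) λ f →
    Injective _≡_ _≡_ f × (∀ a b → adj G (f a) (f b) ≡ adj H a b)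

c4adj : Fin 4 → Fin 4 → Bool
c4adj zero (suc zero) = true
c4adj zero (suc (suc (suc zero))) = true
c4adj (suc zero) zero = true
c4adj (suc zero) (suc (suc zero)) = true
c4adj (suc (suc zero)) (suc zero) = true
c4adj (suc (suc zero)) (suc (suc (suc zero))) = true
c4adj (suc (suc (suc zero))) (suc (suc zero)) = true
c4adj (suc (suc (suc zero))) zero = true
c4adj _ _ = false

C4 : Graph 4
C4 = record { adj = c4adj ; sym = s ; loopless = l }
  where
  s : ∀ i j → c4adj i j ≡ c4adj j i
  s zero zero = refl
  s zero (suc zero) = refl
  s zero (suc (suc zero)) = refl
  s zero (suc (suc (suc zero))) = refl
  s (suc zero) zero = refl
  s (suc zero) (suc zero) = refl
  s (suc zero) (suc (suc zero)) = refl
  s (suc zero) (suc (suc (suc zero))) = refl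
  s (suc (suc zero)) zero = refl
  s (suc (suc zero)) (suc zero) = refl
  s (suc (suc zero)) (suc (suc zero)) = refl
  s (suc (suc zero)) (suc (suc (suc zero))) = refl
  s (suc (suc (suc zero))) zero = refl
  s (suc (suc (suc zero))) (suc zero) = refl
  s (suc (suc (suc zero))) (suc (suc zero)) = refl
  s (suc (suc (suc zero))) (suc (suc (suc zero))) = refl
  l : ∀ i → c4adj i i ≡ false
  l zero = refl
  l (suc zero) = refl
  l (suc (suc zero)) = refl
  l (suc (suc (suc zero))) = refl

data Colour : Set where
  black white gray : Colour

isGray : Colour → Bool
isGray gray = true
isGray _    = false

-- A colouring of unordered pairs: a symmetric function; the diagonal
-- values are irrelevant (only pairs of distinct vertices are ever used).
record Trigraph (n : ℕ) : Set where
  field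
    col : Fin n → Fin n → Colour
    col-sym : ∀ i j → col i j ≡ col j i
open Trigraph public

Realization : ∀ {n} → Trigraph n → Graph n → Set
Realization {n} T G =
  ∀ (i j : Fin n) → ¬ i ≡ j →
    (col T i j ≡ black → adj G i j ≡ true) ×
    (col T i j ≡ white → adj G i j ≡ false)

HasInducedRealization : ∀ {k n} → Graph k → Trigraph n → Set
HasInducedRealization {k} {n} H T =
  ∃[ G ] (Realization T G × InducedCopy H G)

open import Data.Fin using (_≟_)
open import Data.Sum using (_⊎_; inj₁; inj₂)

isPair : ∀ {n} → Fin n → Fin n → Fin n → Fin n → Bool
isPair u v i j with u ≟ i | v ≟ j | u ≟ j | v ≟ i
... | yes _ | yes _ | _ | _ = true
... | _ | _ | yes _ | yes _ = true
... | _ | _ | _ | _ = false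

makeGray : ∀ {n} → Trigraph n → Fin n → Fin n → Trigraph n
makeGray {n} T u v = record { col = c ; col-sym = s }
  where
  c : Fin n → Fin n → Colour
  c i j with isPair u v i j
  ... | true  = gray
  ... | false = col T i j
  s : ∀ i j → c i j ≡ c j i
  s i j with u ≟ i | v ≟ j | u ≟ j | v ≟ i
  ... | yes _ | yes _ | yes _ | yes _ = refl
  ... | yes _ | yes _ | yes _ | no  _ = refl
  ... | yes _ | yes _ | no  _ | yes _ = refl
  ... | yes _ | yes _ | no  _ | no  _ = refl
  ... | yes _ | no  _ | yes _ | yes _ = refl
  ... | no  _ | yes _ | yes _ | yes _ = refl
  ... | no  _ | no  _ | yes _ | yes _ = refl
  ... | yes _ | no  _ | yes _ | no  _ = col-sym T i j
  ... | yes _ | no  _ | no  _ | yes _ = col-sym T i j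
  ... | yes _ | no  _ | no  _ | no  _ = col-sym T i j
  ... | no  _ | yes _ | yes _ | no  _ = col-sym T i j
  ... | no  _ | yes _ | no  _ | yes _ = col-sym T i j
  ... | no  _ | yes _ | no  _ | no  _ = col-sym T i j
  ... | no  _ | no  _ | yes _ | no  _ = col-sym T i j
  ... | no  _ | no  _ | no  _ | yes _ = col-sym T i j
  ... | no  _ | no  _ | no  _ | no  _ = col-sym T i j

InducedSaturated : ∀ {k n} → Graph k → Trigraph n → Set
InducedSaturated {k} {n} H T =
  ¬ HasInducedRealization H T ×
  (∀ (u v : Fin n) → ¬ u ≡ v → ¬ col T u v ≡ gray →
     HasInducedRealization H (makeGray T u v))

-- Number of gray edges: unordered pairs {i,j}, i.e. ordered pairs with
-- toℕ i < toℕ j, whose colour is gray.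
pairs : (n : ℕ) → List (Fin n × Fin n)
pairs n = concatMap (λ i → map (λ j → (i , j)) (allFin n)) (allFin n)

isGrayPair : ∀ {n} → Trigraph n → Fin n × Fin n → Bool
isGrayPair T (i , j) with toℕ i ℕ.<ᵇ toℕ j
... | true  = isGray (col T i j)
... | false = false

grayCount : ∀ {n} → Trigraph n → ℕ
grayCount {n} T = length (filter (λ p → Data.Bool._≟_ (isGrayPair T p) true) (pairs n))
  where import Data.Bool

-- indsat(n,H) = m : m is the minimum number of gray edges of an
-- H-induced-saturated trigraph on n vertices (attained, and a lower bound).
IndSatIs : ∀ {k} → ℕ → Graph k → ℕ → Set
IndSatIs n H m =
  (∃[ T ] (InducedSaturated H T × grayCount {n} T ≡ m)) ×
  (∀ (T : Trigraph n) → InducedSaturated H T → m ≤ grayCount T)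

module Submission where

-- Take the trigraph without gray pairs whose black pairs are the edges of a graph G; its only
-- realization is G itself.  It is C4-induced-saturated as soon as G has no induced C4 while
-- every pair uv lies on a C4 that appears when uv is flipped: an edge uv needs two non-adjacent
-- common neighbours x, y (deleting uv leaves the induced cycle u x v y), a non-edge uv needs an
-- induced path u s t v (adding uv closes it).  The icosahedron has both properties; all of them
-- are conditions on the closed neighbourhood relation, which does not distinguish true twins, so
-- they survive blowing up one vertex into a clique, giving such a graph on every n ≥ 12.

open import Defs
open import Data.Nat using (ℕ; _≤_; _<ᵇ_; _⊓_; z≤n; s≤s)
import Data.Nat.Properties as ℕ
open import Data.Fin using (Fin; zero; suc; toℕ; fromℕ<; inject≤; _≟_)
open import Data.Fin.Properties using (all?; any?; toℕ-fromℕ<; toℕ-inject≤; toℕ≤pred[n]; toℕ-injective)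
open import Data.Bool using (Bool; true; false; not; _∧_; _∨_; if_then_else_)
import Data.Bool as Bool
open import Data.Bool.Properties using (∧-zeroʳ)
open import Data.Empty using (⊥-elim)
open import Data.List using (length)
open import Data.List.Properties using (filter-none)
open import Data.List.Relation.Unary.All using (universal)
open import Data.Product using (∃; ∃₂; _×_; _,_; proj₁; proj₂)
open import Data.Sum using (_⊎_; inj₁; inj₂)
open import Relation.Nullary using (¬_; Dec; yes; no; ¬?)
open import Relation.Nullary.Decidable using (_×-dec_; _⊎-dec_; toWitness; ⌊_⌋; dec-no)
open import Relation.Binary.PropositionalEquality using (_≡_; _≢_; ≢-sym; refl; trans; cong)
import Relation.Binary.PropositionalEquality as ≡
open ≡.≡-Reasoning

module _ {A : Set} (R : A → A → Bool) where

  Square : A → A → A → A → Set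
  Square p q r s =
    R p q ≡ true × R q r ≡ true × R r s ≡ true × R s p ≡ true × R p r ≡ false × R q s ≡ false

  Diamond : A → A → A → A → Set
  Diamond u v x y =
    R u v ≡ true × R u x ≡ true × R v x ≡ true × R u y ≡ true × R v y ≡ true × R x y ≡ false

  InducedP4 : A → A → A → A → Set
  InducedP4 u s t v =
    R u s ≡ true × R s t ≡ true × R t v ≡ true × R u t ≡ false × R s v ≡ false × R u v ≡ false

  FlipWitness : A → A → Set
  FlipWitness u v = (∃₂ λ x y → Diamond u v x y × x ≢ y) ⊎ (∃₂ λ s t → InducedP4 u s t v)

  separated : ∀ {a b c} → R a c ≡ true → R b c ≡ false → a ≢ b
  separated ac bc refl with () ← trans (≡.sym ac) bc

module _ {A : Set} {R : A → A → Bool} (R-sym : ∀ a b → R a b ≡ R b a) where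

  diamond-distinct : ∀ {u v x y} → Diamond R u v x y → u ≢ x × v ≢ x × u ≢ y × v ≢ y
  diamond-distinct {x = x} {y} (_ , ux , vx , uy , vy , xy) =
    separated R uy xy , separated R vy xy , separated R ux yx , separated R vx yx
    where
    yx : R y x ≡ false
    yx = trans (R-sym y x) xy

  inducedP4-distinct : ∀ {u s t v} → InducedP4 R u s t v → u ≢ s × u ≢ t × v ≢ s × v ≢ t × s ≢ t
  inducedP4-distinct (us , st , tv , ut , sv , uv) =
    ≢-sym (separated R st ut) , ≢-sym (separated R tv uv) ,
    ≢-sym (separated R (reversed us) (reversed uv)) , ≢-sym (separated R (reversed st) (reversed sv)) ,
    separated R (reversed us) (reversed ut)
    where
    reversed : ∀ {a b c} → R a b ≡ c → R b a ≡ c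
    reversed {a} {b} = trans (R-sym b a)

pattern c₀ = zero
pattern c₁ = suc zero
pattern c₂ = suc (suc zero)
pattern c₃ = suc (suc (suc zero))

module _ {n} (K : Graph n) where

  adj-swap : ∀ {i j b} → adj K i j ≡ b → adj K j i ≡ b
  adj-swap {i} {j} = trans (sym K j i)

  adjacent⇒≢ : ∀ {i j} → adj K i j ≡ true → i ≢ j
  adjacent⇒≢ {i} ij refl with () ← trans (≡.sym ij) (loopless K i)

  inducedC4⇒square : InducedCopy C4 K →
    ∃₂ λ p q → ∃₂ λ r s → Square (adj K) p q r s × p ≢ r × q ≢ s
  inducedC4⇒square (f , f-injective , f-induced) =
    f c₀ , f c₁ , f c₂ , f c₃ ,
    (f-induced c₀ c₁ , f-induced c₁ c₂ , f-induced c₂ c₃ , f-induced c₃ c₀ ,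
     f-induced c₀ c₂ , f-induced c₁ c₃) ,
    (λ e → c₀≢c₂ (f-injective e)) , (λ e → c₁≢c₃ (f-injective e))
    where
    c₀≢c₂ : c₀ ≢ c₂
    c₀≢c₂ ()
    c₁≢c₃ : c₁ ≢ c₃
    c₁≢c₃ ()

  square⇒inducedC4 : ∀ {p q r s} → Square (adj K) p q r s → p ≢ r → q ≢ s → InducedCopy C4 K
  square⇒inducedC4 {p} {q} {r} {s} (pq , qr , rs , sp , pr , qs) p≢r q≢s = f , f-injective , f-induced
    where
    f : Fin 4 → Fin n
    f c₀ = p
    f c₁ = q
    f c₂ = r
    f c₃ = s

    f-induced : ∀ a b → adj K (f a) (f b) ≡ adj C4 a b
    f-induced c₀ c₀ = loopless K p
    f-induced c₀ c₁ = pq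
    f-induced c₀ c₂ = pr
    f-induced c₀ c₃ = adj-swap sp
    f-induced c₁ c₀ = adj-swap pq
    f-induced c₁ c₁ = loopless K q
    f-induced c₁ c₂ = qr
    f-induced c₁ c₃ = qs
    f-induced c₂ c₀ = adj-swap pr
    f-induced c₂ c₁ = adj-swap qr
    f-induced c₂ c₂ = loopless K r
    f-induced c₂ c₃ = rs
    f-induced c₃ c₀ = sp
    f-induced c₃ c₁ = adj-swap qs
    f-induced c₃ c₂ = adj-swap rs
    f-induced c₃ c₃ = loopless K s

    f-injective : ∀ {a b} → f a ≡ f b → a ≡ b
    f-injective {c₀} {c₀} _ = refl
    f-injective {c₀} {c₁} e = ⊥-elim (adjacent⇒≢ pq e)
    f-injective {c₀} {c₂} e = ⊥-elim (p≢r e)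
    f-injective {c₀} {c₃} e = ⊥-elim (adjacent⇒≢ sp (≡.sym e))
    f-injective {c₁} {c₀} e = ⊥-elim (adjacent⇒≢ pq (≡.sym e))
    f-injective {c₁} {c₁} _ = refl
    f-injective {c₁} {c₂} e = ⊥-elim (adjacent⇒≢ qr e)
    f-injective {c₁} {c₃} e = ⊥-elim (q≢s e)
    f-injective {c₂} {c₀} e = ⊥-elim (p≢r (≡.sym e))
    f-injective {c₂} {c₁} e = ⊥-elim (adjacent⇒≢ qr (≡.sym e))
    f-injective {c₂} {c₂} _ = refl
    f-injective {c₂} {c₃} e = ⊥-elim (adjacent⇒≢ rs e)
    f-injective {c₃} {c₀} e = ⊥-elim (adjacent⇒≢ sp e)
    f-injective {c₃} {c₁} e = ⊥-elim (q≢s (≡.sym e))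
    f-injective {c₃} {c₂} e = ⊥-elim (adjacent⇒≢ rs (≡.sym e))
    f-injective {c₃} {c₃} _ = refl

inducedCopy-transport : ∀ {k n} {H : Graph k} {G G′ : Graph n} →
  (∀ i j → i ≢ j → adj G′ i j ≡ adj G i j) → InducedCopy H G′ → InducedCopy H G
inducedCopy-transport {H = H} {G} agree (f , f-injective , f-induced) = f , f-injective , f-induced′
  where
  f-induced′ : ∀ a b → adj G (f a) (f b) ≡ adj H a b
  f-induced′ a b with a ≟ b
  ... | yes refl = trans (loopless G (f a)) (≡.sym (loopless H a))
  ... | no a≢b = trans (≡.sym (agree _ _ (λ e → a≢b (f-injective e)))) (f-induced a b)

colourOf : Bool → Colour
colourOf true = black
colourOf false = white

colourOf-nonGray : ∀ b → isGray (colourOf b) ≢ true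
colourOf-nonGray true ()
colourOf-nonGray false ()

asTrigraph : ∀ {n} → Graph n → Trigraph n
asTrigraph G = record { col = λ i j → colourOf (adj G i j) ; col-sym = λ i j → cong colourOf (sym G i j) }

module _ {n} (G : Graph n) where

  asTrigraph-grayCount : grayCount (asTrigraph G) ≡ 0
  asTrigraph-grayCount =
    cong length (filter-none (λ p → isGrayPair (asTrigraph G) p Bool.≟ true) (universal no-gray (pairs n)))
    where
    no-gray : ∀ p → isGrayPair (asTrigraph G) p ≢ true
    no-gray (i , j) with toℕ i <ᵇ toℕ j
    ... | true  = colourOf-nonGray (adj G i j)
    ... | false = λ ()

  realization-asTrigraph : ∀ {G′} → Realization (asTrigraph G) G′ → ∀ i j → i ≢ j → adj G′ i j ≡ adj G i j
  realization-asTrigraph real i j i≢j with adj G i j in e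
  ... | true  = proj₁ (real i j i≢j) (cong colourOf e)
  ... | false = proj₂ (real i j i≢j) (cong colourOf e)

module _ {n} (u v : Fin n) where

  isPair-sym : ∀ i j → isPair u v i j ≡ isPair u v j i
  isPair-sym i j with u ≟ i | v ≟ j | u ≟ j | v ≟ i
  ... | yes _ | yes _ | yes _ | yes _ = refl
  ... | yes _ | yes _ | yes _ | no  _ = refl
  ... | yes _ | yes _ | no  _ | yes _ = refl
  ... | yes _ | yes _ | no  _ | no  _ = refl
  ... | yes _ | no  _ | yes _ | yes _ = refl
  ... | yes _ | no  _ | yes _ | no  _ = refl
  ... | yes _ | no  _ | no  _ | yes _ = refl
  ... | yes _ | no  _ | no  _ | no  _ = refl
  ... | no  _ | yes _ | yes _ | yes _ = refl
  ... | no  _ | yes _ | yes _ | no  _ = refl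
  ... | no  _ | yes _ | no  _ | yes _ = refl
  ... | no  _ | yes _ | no  _ | no  _ = refl
  ... | no  _ | no  _ | yes _ | yes _ = refl
  ... | no  _ | no  _ | yes _ | no  _ = refl
  ... | no  _ | no  _ | no  _ | yes _ = refl
  ... | no  _ | no  _ | no  _ | no  _ = refl

  isPair-self : isPair u v u v ≡ true
  isPair-self with u ≟ u | v ≟ v
  ... | yes _ | yes _ = refl
  ... | no u≢u | _ = ⊥-elim (u≢u refl)
  ... | _ | no v≢v = ⊥-elim (v≢v refl)

  isPair-diagonal : u ≢ v → ∀ i → isPair u v i i ≡ false
  isPair-diagonal u≢v i with u ≟ i | v ≟ i
  ... | yes u≡i | yes v≡i = ⊥-elim (u≢v (trans u≡i (≡.sym v≡i)))
  ... | yes _ | no _ = refl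
  ... | no _ | yes _ = refl
  ... | no _ | no _ = refl

  isPair-outsideˡ : ∀ {i} j → u ≢ i → v ≢ i → isPair u v i j ≡ false
  isPair-outsideˡ {i} j u≢i v≢i with u ≟ i | v ≟ i | u ≟ j
  ... | yes u≡i | _ | _ = ⊥-elim (u≢i u≡i)
  ... | _ | yes v≡i | _ = ⊥-elim (v≢i v≡i)
  ... | no _ | no _ | yes _ = refl
  ... | no _ | no _ | no _ = refl

  isPair-outsideʳ : ∀ i {j} → u ≢ j → v ≢ j → isPair u v i j ≡ false
  isPair-outsideʳ i {j} u≢j v≢j = trans (isPair-sym i j) (isPair-outsideˡ i u≢j v≢j)

module Flip {n} (G : Graph n) {u v : Fin n} (u≢v : u ≢ v) where

  flipAdj : Fin n → Fin n → Bool
  flipAdj i j = if isPair u v i j then not (adj G i j) else adj G i j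

  flipped : Graph n
  flipped = record { adj = flipAdj ; sym = flipAdj-sym ; loopless = flipAdj-loopless }
    where
    flipAdj-sym : ∀ i j → flipAdj i j ≡ flipAdj j i
    flipAdj-sym i j rewrite isPair-sym u v i j | sym G i j = refl

    flipAdj-loopless : ∀ i → flipAdj i i ≡ false
    flipAdj-loopless i rewrite isPair-diagonal u v u≢v i = loopless G i

  flipped-realizes : Realization (makeGray (asTrigraph G) u v) flipped
  flipped-realizes i j _ with isPair u v i j
  ... | true = (λ ()) , (λ ())
  ... | false with adj G i j
  ...   | true  = (λ _ → refl) , (λ ())
  ...   | false = (λ ()) , (λ _ → refl)

  flipped-pair : flipAdj u v ≡ not (adj G u v)
  flipped-pair rewrite isPair-self u v = refl

  flipped-outsideˡ : ∀ {i} j → u ≢ i → v ≢ i → flipAdj i j ≡ adj G i j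
  flipped-outsideˡ j u≢i v≢i rewrite isPair-outsideˡ u v j u≢i v≢i = refl

  flipped-outsideʳ : ∀ i {j} → u ≢ j → v ≢ j → flipAdj i j ≡ adj G i j
  flipped-outsideʳ i u≢j v≢j rewrite isPair-outsideʳ u v i u≢j v≢j = refl

  diamond⇒flippedC4 : ∀ {x y} → Diamond (adj G) u v x y → x ≢ y → InducedCopy C4 flipped
  diamond⇒flippedC4 {y = y} D@(uv , ux , vx , uy , vy , xy) x≢y with diamond-distinct (sym G) D
  ... | u≢x , v≢x , u≢y , v≢y =
    square⇒inducedC4 flipped
      ( trans (flipped-outsideʳ u u≢x v≢x) ux
      , trans (flipped-outsideˡ v u≢x v≢x) (adj-swap G vx)
      , trans (flipped-outsideʳ v u≢y v≢y) vy
      , trans (flipped-outsideˡ u u≢y v≢y) (adj-swap G uy)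
      , trans flipped-pair (cong not uv)
      , trans (flipped-outsideˡ y u≢x v≢x) xy )
      u≢v x≢y

  inducedP4⇒flippedC4 : ∀ {s t} → InducedP4 (adj G) u s t v → InducedCopy C4 flipped
  inducedP4⇒flippedC4 {s = s} P@(us , st , tv , ut , sv , uv) with inducedP4-distinct (sym G) P
  ... | u≢s , u≢t , v≢s , v≢t , _ =
    square⇒inducedC4 flipped
      ( trans flipped-pair (cong not uv)
      , trans (flipped-outsideʳ v u≢t v≢t) (adj-swap G tv)
      , trans (flipped-outsideˡ s u≢t v≢t) (adj-swap G st)
      , trans (flipped-outsideˡ u u≢s v≢s) (adj-swap G us)
      , trans (flipped-outsideʳ u u≢t v≢t) ut
      , trans (flipped-outsideʳ v u≢s v≢s) (adj-swap G sv) )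
      u≢t v≢s

  flipWitness⇒flippedC4 : FlipWitness (adj G) u v → InducedCopy C4 flipped
  flipWitness⇒flippedC4 (inj₁ (_ , _ , D , x≢y)) = diamond⇒flippedC4 D x≢y
  flipWitness⇒flippedC4 (inj₂ (_ , _ , P))       = inducedP4⇒flippedC4 P

asTrigraph-C4-saturated : ∀ {n} (G : Graph n) → ¬ InducedCopy C4 G →
  (∀ u v → u ≢ v → FlipWitness (adj G) u v) → InducedSaturated C4 (asTrigraph G)
asTrigraph-C4-saturated G C4-free witness = no-C4-realization , flips-to-C4
  where
  no-C4-realization : ¬ HasInducedRealization C4 (asTrigraph G)
  no-C4-realization (G′ , real , copy) =
    C4-free (inducedCopy-transport {H = C4} {G} {G′} (realization-asTrigraph G {G′} real) copy)

  flips-to-C4 : ∀ u v → u ≢ v → ¬ col (asTrigraph G) u v ≡ gray →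
    HasInducedRealization C4 (makeGray (asTrigraph G) u v)
  flips-to-C4 u v u≢v _ = flipped , flipped-realizes , flipWitness⇒flippedC4 (witness u v u≢v)
    where open Flip G u≢v

module BlowUp {k n} (N : Fin k → Fin k → Bool) (N-sym : ∀ a b → N a b ≡ N b a) (m : Fin n → Fin k) where

  blowUpAdj : Fin n → Fin n → Bool
  blowUpAdj i j = not ⌊ i ≟ j ⌋ ∧ N (m i) (m j)

  blowUp : Graph n
  blowUp = record { adj = blowUpAdj ; sym = blowUpAdj-sym ; loopless = blowUpAdj-loopless }
    where
    blowUpAdj-sym : ∀ i j → blowUpAdj i j ≡ blowUpAdj j i
    blowUpAdj-sym i j with i ≟ j | j ≟ i
    ... | yes _   | yes _   = refl
    ... | no  _   | no  _   = N-sym (m i) (m j)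
    ... | yes i≡j | no  j≢i = ⊥-elim (j≢i (≡.sym i≡j))
    ... | no  i≢j | yes j≡i = ⊥-elim (i≢j (≡.sym j≡i))

    blowUpAdj-loopless : ∀ i → blowUpAdj i i ≡ false
    blowUpAdj-loopless i with i ≟ i
    ... | yes _ = refl
    ... | no i≢i = ⊥-elim (i≢i refl)

  ≢-fibres : ∀ {i j} → m i ≢ m j → i ≢ j
  ≢-fibres mi≢mj i≡j = mi≢mj (cong m i≡j)

  blowUp-adj : ∀ {i j} → i ≢ j → blowUpAdj i j ≡ N (m i) (m j)
  blowUp-adj {i} {j} i≢j rewrite dec-no (i ≟ j) i≢j = refl

  blowUp-adjacent⇒ : ∀ {i j} → blowUpAdj i j ≡ true → N (m i) (m j) ≡ true
  blowUp-adjacent⇒ {i} {j} ij with i ≟ j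
  ... | no _ = ij

  blowUp-nonadjacent : ∀ {i j} → N (m i) (m j) ≡ false → blowUpAdj i j ≡ false
  blowUp-nonadjacent {i} {j} ij rewrite ij = ∧-zeroʳ _

  blowUp-C4-free : (∀ a b c d → ¬ Square N a b c d) → ¬ InducedCopy C4 blowUp
  blowUp-C4-free N-C4-free copy with inducedC4⇒square blowUp copy
  ... | _ , _ , _ , _ , (pq , qr , rs , sp , pr , qs) , p≢r , q≢s =
    N-C4-free _ _ _ _
      ( blowUp-adjacent⇒ pq , blowUp-adjacent⇒ qr , blowUp-adjacent⇒ rs , blowUp-adjacent⇒ sp
      , trans (≡.sym (blowUp-adj p≢r)) pr , trans (≡.sym (blowUp-adj q≢s)) qs )

  private
    lift-adjacent : ∀ {i j} → m i ≢ m j → N (m i) (m j) ≡ true → blowUpAdj i j ≡ true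
    lift-adjacent mi≢mj = trans (blowUp-adj (≢-fibres mi≢mj))

  lift-diamond : ∀ {u v x y} → u ≢ v → Diamond N (m u) (m v) (m x) (m y) → Diamond blowUpAdj u v x y
  lift-diamond u≢v D@(uv , ux , vx , uy , vy , xy) with diamond-distinct N-sym D
  ... | u≢x , v≢x , u≢y , v≢y =
    trans (blowUp-adj u≢v) uv , lift-adjacent u≢x ux , lift-adjacent v≢x vx ,
    lift-adjacent u≢y uy , lift-adjacent v≢y vy , blowUp-nonadjacent xy

  lift-inducedP4 : ∀ {u s t v} → InducedP4 N (m u) (m s) (m t) (m v) → InducedP4 blowUpAdj u s t v
  lift-inducedP4 P@(us , st , tv , ut , sv , uv) with inducedP4-distinct N-sym P
  ... | u≢s , _ , _ , v≢t , s≢t =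
    lift-adjacent u≢s us , lift-adjacent s≢t st , lift-adjacent (≢-sym v≢t) tv ,
    blowUp-nonadjacent ut , blowUp-nonadjacent sv , blowUp-nonadjacent uv

  blowUp-flipWitness : (∀ a → ∃ λ i → m i ≡ a) → (∀ a b → FlipWitness N a b) →
    ∀ u v → u ≢ v → FlipWitness blowUpAdj u v
  blowUp-flipWitness m-surjective witness u v u≢v = lift (witness (m u) (m v))
    where
    lift : FlipWitness N (m u) (m v) → FlipWitness blowUpAdj u v
    lift (inj₁ (a , b , D , a≢b)) with m-surjective a | m-surjective b
    ... | x , refl | y , refl = inj₁ (x , y , lift-diamond u≢v D , ≢-fibres a≢b)
    lift (inj₂ (a , b , P)) with m-surjective a | m-surjective b
    ... | s , refl | t , refl = inj₂ (s , t , lift-inducedP4 P)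

module _ {k} (R : Fin k → Fin k → Bool) where

  private
    _∼_≟_ : ∀ a b c → Dec (R a b ≡ c)
    a ∼ b ≟ c = R a b Bool.≟ c

  square? : ∀ p q r s → Dec (Square R p q r s)
  square? p q r s =
    p ∼ q ≟ true ×-dec q ∼ r ≟ true ×-dec r ∼ s ≟ true ×-dec s ∼ p ≟ true ×-dec
    p ∼ r ≟ false ×-dec q ∼ s ≟ false

  diamond? : ∀ u v x y → Dec (Diamond R u v x y)
  diamond? u v x y =
    u ∼ v ≟ true ×-dec u ∼ x ≟ true ×-dec v ∼ x ≟ true ×-dec u ∼ y ≟ true ×-dec
    v ∼ y ≟ true ×-dec x ∼ y ≟ false

  inducedP4? : ∀ u s t v → Dec (InducedP4 R u s t v)
  inducedP4? u s t v =
    u ∼ s ≟ true ×-dec s ∼ t ≟ true ×-dec t ∼ v ≟ true ×-dec u ∼ t ≟ false ×-dec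
    s ∼ v ≟ false ×-dec u ∼ v ≟ false

  flipWitness? : ∀ u v → Dec (FlipWitness R u v)
  flipWitness? u v =
    (any? λ x → any? λ y → diamond? u v x y ×-dec ¬? (x ≟ y)) ⊎-dec
    (any? λ s → any? λ t → inducedP4? u s t v)

-- Vertex 0 is the top, 1–5 the upper pentagon, 6–10 the lower pentagon and 11 the bottom.
icosahedronEdge : ℕ → ℕ → Bool
icosahedronEdge 0 1 = true
icosahedronEdge 0 2 = true
icosahedronEdge 0 3 = true
icosahedronEdge 0 4 = true
icosahedronEdge 0 5 = true
icosahedronEdge 1 2 = true
icosahedronEdge 2 3 = true
icosahedronEdge 3 4 = true
icosahedronEdge 4 5 = true
icosahedronEdge 5 1 = true
icosahedronEdge 1 6 = true
icosahedronEdge 1 7 = true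
icosahedronEdge 2 7 = true
icosahedronEdge 2 8 = true
icosahedronEdge 3 8 = true
icosahedronEdge 3 9 = true
icosahedronEdge 4 9 = true
icosahedronEdge 4 10 = true
icosahedronEdge 5 10 = true
icosahedronEdge 5 6 = true
icosahedronEdge 6 7 = true
icosahedronEdge 7 8 = true
icosahedronEdge 8 9 = true
icosahedronEdge 9 10 = true
icosahedronEdge 10 6 = true
icosahedronEdge 11 6 = true
icosahedronEdge 11 7 = true
icosahedronEdge 11 8 = true
icosahedronEdge 11 9 = true
icosahedronEdge 11 10 = true
icosahedronEdge _ _ = false

closedIcosahedron : Fin 12 → Fin 12 → Bool
closedIcosahedron a b = ⌊ a ≟ b ⌋ ∨ icosahedronEdge (toℕ a) (toℕ b) ∨ icosahedronEdge (toℕ b) (toℕ a)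

closedIcosahedron-sym : ∀ a b → closedIcosahedron a b ≡ closedIcosahedron b a
closedIcosahedron-sym =
  toWitness {a? = all? λ a → all? λ b → closedIcosahedron a b Bool.≟ closedIcosahedron b a} _

closedIcosahedron-C4-free : ∀ a b c d → ¬ Square closedIcosahedron a b c d
closedIcosahedron-C4-free =
  toWitness {a? = all? λ a → all? λ b → all? λ c → all? λ d → ¬? (square? closedIcosahedron a b c d)} _

closedIcosahedron-flipWitness : ∀ a b → FlipWitness closedIcosahedron a b
closedIcosahedron-flipWitness =
  toWitness {a? = all? λ a → all? λ b → flipWitness? closedIcosahedron a b} _

-- All vertices from 11 on are sent to the bottom vertex, which is thereby blown up.
collapse : ∀ {n} → Fin n → Fin 12
collapse i = fromℕ< (s≤s (ℕ.m⊓n≤n (toℕ i) 11))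

collapse-surjective : ∀ {n} → 12 ≤ n → ∀ a → ∃ λ i → collapse {n} i ≡ a
collapse-surjective 12≤n a = inject≤ a 12≤n , toℕ-injective (begin
  toℕ (collapse (inject≤ a 12≤n)) ≡⟨ toℕ-fromℕ< _ ⟩
  toℕ (inject≤ a 12≤n) ⊓ 11        ≡⟨ cong (_⊓ 11) (toℕ-inject≤ a 12≤n) ⟩
  toℕ a ⊓ 11                        ≡⟨ ℕ.m≤n⇒m⊓n≡m (toℕ≤pred[n] a) ⟩
  toℕ a                             ∎)

corollary5p4 : ∀ (n : ℕ) → 12 ≤ n → IndSatIs n C4 0
corollary5p4 n 12≤n = (asTrigraph blowUp , saturated , asTrigraph-grayCount blowUp) , λ _ _ → z≤n
  where
  open BlowUp closedIcosahedron closedIcosahedron-sym (collapse {n})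
  saturated : InducedSaturated C4 (asTrigraph blowUp)
  saturated =
    asTrigraph-C4-saturated blowUp (blowUp-C4-free closedIcosahedron-C4-free)
      (blowUp-flipWitness (collapse-surjective 12≤n) closedIcosahedron-flipWitness)
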